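{- Let $\mathbb{I}$ be a $J$-non-foldable $\tau$-structure (with $J\subseteq I$), and let $\mathbb{K}$ be a symmetric $\tau$-structure obtained from $\mathbb{I}^2$ by a dismantling sequence in which only non-diagonal elements are removed. Assume that $\mathbb{K}$ is minimal, i.e., no proper substructure of $\mathbb{K}$ is a symmetric structure obtained from $\mathbb{I}^2$ in this way. Then $\mathbb{K}$ is $\Delta(J^2)$-non-foldable, where $\Delta(J^2)=\{(a,a):a\in J\}$.
   Context: A signature $\tau$ is a set of relation symbols with arities; a $\tau$-structure $\mathbb{H}$ has a countable universe $H$ and relations $R(\mathbb{H})\subseteq H^k$ for $k$-ary $R\in\tau$. $b$ dominates $a$ in $\mathbb{H}$ if for every $k$-ary $R$, every $i$, and every $(a_1,\dots,a_k)\in R(\mathbb{H})$ with $a_i=a$, $(a_1,\dots,a_{i-1},b,a_{i+1},\dots,a_k)\in R(\mathbb{H})$; $a$ is dominated if it is dominated by some $b\ne a$. For $X\subseteq H$, $\mathbb{H}$ is $X$-non-foldable if every dominated element lies in $X$. A dismantling sequence is $\mathbb{J}_0,\dots,\mathbb{J}_\ell$ where each $\mathbb{J}_{j+1}$ is the substructure of $\mathbb{J}_j$ induced by $J_j\setminus\{a_j\}$ (i.e. $R(\mathbb{J}_{j+1})=R(\mathbb{J}_j)\cap J_{j+1}^k$) for some element $a_j$ dominated in $\mathbb{J}_j$; $a_j$ is said to be removed (folded). $\mathbb{I}^2$ is the product structure on $I\times I$ (a tuple of pairs lies in $R(\mathbb{I}^2)$ iff both coordinate tuples lie in $R(\mathbb{I})$);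 an element $(a,b)$ is diagonal if $a=b$. A substructure $\mathbb{K}$ of $\mathbb{I}^2$ is symmetric if $(a,b)\in K\iff(b,a)\in K$. -}

module Defs where

open import Data.Nat using (ℕ)
open import Data.Fin using (Fin)
open import Data.Vec using (Vec; lookup; map; _[_]≔_)
open import Data.Vec.Relation.Unary.All using (All)
open import Data.Product using (Σ; _×_; _,_; proj₁; proj₂)
open import Relation.Nullary using (¬_)
open import Relation.Binary.PropositionalEquality using (_≡_; _≢_)
open import Function.Definitions using (Injective)
open import Data.Unit using (⊤)

record Signature : Set₁ where
  field
    Sym : Set
    ar  : Sym → ℕ
open Signature public

-- A τ-structure (countability of the universe is the separate predicate Countable).
record Structure (τ : Signature) : Set₁ where
  field
    U         : Set
    rel       : (R : Sym τ) → Vec U (ar τ R) → Set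
open Structure public

Countable : Set → Set
Countable A = Σ (A → ℕ) (λ f → Injective _≡_ _≡_ f)

-- Subsets of a universe; an (induced) substructure is given by its universe.
Subset : Set → Set₁
Subset A = A → Set

full : {A : Set} → Subset A
full _ = ⊤

_⊆_ : {A : Set} → Subset A → Subset A → Set
S ⊆ T = ∀ x → S x → T x

_─_ : {A : Set} → Subset A → A → Subset A
(S ─ a) x = S x × x ≢ a

module _ {τ : Signature} (𝔸 : Structure τ) where

  -- b dominates a in the substructure of 𝔸 induced by S
  -- (relations of the induced substructure are those of 𝔸 restricted to tuples from S)
  Dominates : Subset (U 𝔸) → U 𝔸 → U 𝔸 → Set
  Dominates S b a =
    ∀ (R : Sym τ) (i : Fin (ar τ R)) (t : Vec (U 𝔸) (ar τ R)) →
      All S t → rel 𝔸 R t → lookup t i ≡ a →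
      rel 𝔸 R (t [ i ]≔ b)

  Dominated : Subset (U 𝔸) → U 𝔸 → Set
  Dominated S a = Σ (U 𝔸) λ b → S b × b ≢ a × Dominates S b a

  NonFoldable : Subset (U 𝔸) → Subset (U 𝔸) → Set
  NonFoldable S X = ∀ a → S a → Dominated S a → X a

  data Dismantle (ok : Subset (U 𝔸)) : Subset (U 𝔸) → Subset (U 𝔸) → Set₁ where
    done : ∀ {S T} → S ⊆ T → T ⊆ S → Dismantle ok S T
    fold : ∀ {S T} (a : U 𝔸) → S a → Dominated S a → ok a →
           Dismantle ok (S ─ a) T → Dismantle ok S T

square : {τ : Signature} → Structure τ → Structure τ
square {τ} 𝕀 = record
  { U = U 𝕀 × U 𝕀
  ; rel = λ R t → rel 𝕀 R (map proj₁ t) × rel 𝕀 R (map proj₂ t)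
  }

Symmetric : {A : Set} → Subset (A × A) → Set
Symmetric K = ∀ a b → (K (a , b) → K (b , a)) × (K (b , a) → K (a , b))

NonDiagonal : {A : Set} → Subset (A × A)
NonDiagonal (a , b) = a ≢ b

Δ² : {A : Set} → Subset A → Subset (A × A)
Δ² J (a , b) = J a × a ≡ b

SymObtained : {τ : Signature} (𝕀 : Structure τ) → Subset (U 𝕀 × U 𝕀) → Set₁
SymObtained 𝕀 K = Symmetric K × Dismantle (square 𝕀) NonDiagonal full K

Minimal : {τ : Signature} (𝕀 : Structure τ) → Subset (U 𝕀 × U 𝕀) → Set₁
Minimal 𝕀 K = ∀ (K′ : Subset (U 𝕀 × U 𝕀)) → K′ ⊆ K → SymObtained 𝕀 K′ →
  ¬ (Σ (U 𝕀 × U 𝕀) λ x → K x × ¬ K′ x)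

module Submission where

-- A diagonal element (a , a) survives every dismantling of 𝕀² that removes only non-diagonal
-- elements, so the whole diagonal lies in K; feeding diagonal tuples to a dominator (c , d) of
-- (a , a) shows that c and d both dominate a in 𝕀, and one of them differs from a, so a ∈ J.
-- A dominated non-diagonal (a , b) can instead be folded, after which the symmetric image of
-- its dominator still dominates (b , a); removing both yields a smaller symmetric structure
-- obtained from 𝕀², contradicting minimality.

open import Defs
open import Data.Product using (_×_; _,_; proj₁; proj₂; swap)
open import Data.Fin using (Fin)
open import Data.Vec using (Vec; lookup; map; _[_]≔_)
open import Data.Vec.Properties using (lookup-map; map-[]≔; map-∘; map-id; []≔-lookup)
import Data.Vec.Relation.Unary.All as All
open import Data.Vec.Relation.Unary.All.Properties using (map⁺)
open import Data.Nat.Properties using (eq?)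
open import Data.Unit using (tt)
open import Data.Empty using (⊥-elim)
open import Function using (_∘_; mk↣)
open import Relation.Nullary using (¬_; yes; no)
open import Relation.Binary.Definitions using (DecidableEquality)
open import Relation.Binary.PropositionalEquality

Countable⇒DecidableEquality : {A : Set} → Countable A → DecidableEquality A
Countable⇒DecidableEquality (f , f-injective) = eq? (mk↣ f-injective)

module _ {τ : Signature} (𝔸 : Structure τ) where

  Dominates-antimono : ∀ {S T b a} → T ⊆ S → Dominates 𝔸 S b a → Dominates 𝔸 T b a
  Dominates-antimono T⊆S dom R i t t∈T = dom R i t (All.map (T⊆S _) t∈T)

  Dismantle-retains : ∀ {ok S T} → Dismantle 𝔸 ok S T → ∀ x → ¬ ok x → S x → T x
  Dismantle-retains (done S⊆T _) x ¬ok x∈S = S⊆T x x∈S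
  Dismantle-retains (fold a _ _ ok-a rest) x ¬ok x∈S =
    Dismantle-retains rest x ¬ok (x∈S , λ { refl → ¬ok ok-a })

  Dismantle-respˡ : ∀ {ok S S′ T} → S ⊆ S′ → S′ ⊆ S → Dismantle 𝔸 ok S′ T → Dismantle 𝔸 ok S T
  Dismantle-respˡ S⊆S′ S′⊆S (done S′⊆T T⊆S′) =
    done (λ x → S′⊆T x ∘ S⊆S′ x) (λ x → S′⊆S x ∘ T⊆S′ x)
  Dismantle-respˡ S⊆S′ S′⊆S (fold a a∈S′ (b , b∈S′ , b≢a , dom) ok-a rest) =
    fold a (S′⊆S a a∈S′) (b , S′⊆S b b∈S′ , b≢a , Dominates-antimono S⊆S′ dom) ok-a
      (Dismantle-respˡ (λ x (x∈S , x≢a) → S⊆S′ x x∈S , x≢a) (λ x (x∈S′ , x≢a) → S′⊆S x x∈S′ , x≢a) rest)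

  Dismantle-trans : ∀ {ok S T V} → Dismantle 𝔸 ok S T → Dismantle 𝔸 ok T V → Dismantle 𝔸 ok S V
  Dismantle-trans (done S⊆T T⊆S) T→V = Dismantle-respˡ S⊆T T⊆S T→V
  Dismantle-trans (fold a a∈S dom ok-a rest) T→V = fold a a∈S dom ok-a (Dismantle-trans rest T→V)

module _ {τ : Signature} (𝕀 : Structure τ) where

  private
    A  = U 𝕀
    𝕀² = square 𝕀

  diagonal : A → A × A
  diagonal x = x , x

  map-proj₁-swap : ∀ {n} (t : Vec (A × A) n) → map proj₁ (map swap t) ≡ map proj₂ t
  map-proj₁-swap t = sym (map-∘ proj₁ swap t)

  map-proj₂-swap : ∀ {n} (t : Vec (A × A) n) → map proj₂ (map swap t) ≡ map proj₁ t
  map-proj₂-swap t = sym (map-∘ proj₂ swap t)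

  map-swap-involutive : ∀ {n} (t : Vec (A × A) n) → map swap (map swap t) ≡ t
  map-swap-involutive t = trans (sym (map-∘ swap swap t)) (map-id t)

  map-proj₁-diagonal : ∀ {n} (t : Vec A n) → map proj₁ (map diagonal t) ≡ t
  map-proj₁-diagonal t = trans (sym (map-∘ proj₁ diagonal t)) (map-id t)

  map-proj₂-diagonal : ∀ {n} (t : Vec A n) → map proj₂ (map diagonal t) ≡ t
  map-proj₂-diagonal t = trans (sym (map-∘ proj₂ diagonal t)) (map-id t)

  rel²-swap : ∀ {R t} → rel 𝕀² R t → rel 𝕀² R (map swap t)
  rel²-swap {R} {t} (r₁ , r₂) =
    subst (rel 𝕀 R) (sym (map-proj₁-swap t)) r₂ , subst (rel 𝕀 R) (sym (map-proj₂-swap t)) r₁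

  rel²-diagonal : ∀ {R t} → rel 𝕀 R t → rel 𝕀² R (map diagonal t)
  rel²-diagonal {R} {t} r =
    subst (rel 𝕀 R) (sym (map-proj₁-diagonal t)) r , subst (rel 𝕀 R) (sym (map-proj₂-diagonal t)) r

  Dominates-swap : ∀ {K} → Symmetric K → ∀ {a b c d} →
    Dominates 𝕀² K (c , d) (a , b) → Dominates 𝕀² K (d , c) (b , a)
  Dominates-swap {K} symmetric {a} {b} {c} {d} dom R i t t∈K r t[i]≡ba =
    subst (rel 𝕀² R) swapped (rel²-swap (dom R i (map swap t) swapped∈K (rel²-swap r) swapped-lookup))
    where
    swapped∈K : All.All K (map swap t)
    swapped∈K = map⁺ (All.map (λ {(x , y)} → proj₁ (symmetric x y)) t∈K)
    swapped-lookup : lookup (map swap t) i ≡ (a , b)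
    swapped-lookup = trans (lookup-map i swap t) (cong swap t[i]≡ba)
    swapped : map swap (map swap t [ i ]≔ (c , d)) ≡ t [ i ]≔ (d , c)
    swapped = trans (map-[]≔ swap (map swap t) i) (cong (_[ i ]≔ (d , c)) (map-swap-involutive t))

  Dominates-fixProj₁ : ∀ {K x y c d} → Dominates 𝕀² K (c , d) (x , y) → Dominates 𝕀² K (x , d) (x , y)
  Dominates-fixProj₁ {K} {x} {y} {c} {d} dom R i t t∈K r@(r₁ , _) t[i]≡xy =
    subst (rel 𝕀 R) (sym first-unchanged) r₁ , subst (rel 𝕀 R) same-second (proj₂ (dom R i t t∈K r t[i]≡xy))
    where
    open ≡-Reasoning
    first-unchanged : map proj₁ (t [ i ]≔ (x , d)) ≡ map proj₁ t
    first-unchanged = begin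
      map proj₁ (t [ i ]≔ (x , d))                 ≡⟨ map-[]≔ proj₁ t i ⟩
      map proj₁ t [ i ]≔ x                         ≡⟨ cong (map proj₁ t [ i ]≔_) (cong proj₁ (sym t[i]≡xy)) ⟩
      map proj₁ t [ i ]≔ proj₁ (lookup t i)        ≡⟨ cong (map proj₁ t [ i ]≔_) (sym (lookup-map i proj₁ t)) ⟩
      map proj₁ t [ i ]≔ lookup (map proj₁ t) i    ≡⟨ []≔-lookup (map proj₁ t) i ⟩
      map proj₁ t                                  ∎
    same-second : map proj₂ (t [ i ]≔ (c , d)) ≡ map proj₂ (t [ i ]≔ (x , d))
    same-second = trans (map-[]≔ proj₂ t i) (sym (map-[]≔ proj₂ t i))

  Dominates-diagonal : ∀ {K} → (∀ x → K (x , x)) → ∀ {a c d} →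
    Dominates 𝕀² K (c , d) (a , a) → Dominates 𝕀 full c a × Dominates 𝕀 full d a
  Dominates-diagonal diagonal∈K {a} {c} {d} dom =
    (λ R i t _ r t[i]≡a → subst (rel 𝕀 R) (first t) (proj₁ (lifted R i t r t[i]≡a))) ,
    (λ R i t _ r t[i]≡a → subst (rel 𝕀 R) (second t) (proj₂ (lifted R i t r t[i]≡a)))
    where
    lifted : ∀ R i t → rel 𝕀 R t → lookup t i ≡ a → rel 𝕀² R (map diagonal t [ i ]≔ (c , d))
    lifted R i t r t[i]≡a = dom R i (map diagonal t) (map⁺ (All.universal diagonal∈K t)) (rel²-diagonal r)
      (trans (lookup-map i diagonal t) (cong diagonal t[i]≡a))
    first : ∀ {n} {i : Fin n} t → map proj₁ (map diagonal t [ i ]≔ (c , d)) ≡ t [ i ]≔ c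
    first {i = i} t = trans (map-[]≔ proj₁ (map diagonal t) i) (cong (_[ i ]≔ c) (map-proj₁-diagonal t))
    second : ∀ {n} {i : Fin n} t → map proj₂ (map diagonal t [ i ]≔ (c , d)) ≡ t [ i ]≔ d
    second {i = i} t = trans (map-[]≔ proj₂ (map diagonal t) i) (cong (_[ i ]≔ d) (map-proj₂-diagonal t))

  SymObtained-diagonal : ∀ {K} → SymObtained 𝕀 K → ∀ x → K (x , x)
  SymObtained-diagonal (_ , full→K) x = Dismantle-retains 𝕀² full→K (x , x) (λ x≢x → x≢x refl) _

  Dominated-diagonal⇒Dominated : DecidableEquality A → ∀ {K} → (∀ x → K (x , x)) → ∀ {a} →
    Dominated 𝕀² K (a , a) → Dominated 𝕀 full a
  Dominated-diagonal⇒Dominated _≟_ diagonal∈K {a} ((c , d) , _ , cd≢aa , dom) with c ≟ a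
  ... | no c≢a    = c , tt , c≢a , proj₁ (Dominates-diagonal diagonal∈K dom)
  ... | yes refl  = d , tt , (λ d≡a → cd≢aa (cong (c ,_) d≡a)) , proj₂ (Dominates-diagonal diagonal∈K dom)

  Symmetric-removePair : ∀ {K : Subset (A × A)} → Symmetric K → ∀ a b → Symmetric ((K ─ (a , b)) ─ (b , a))
  Symmetric-removePair symmetric a b x y =
    (λ ((xy∈K , xy≢ab) , xy≢ba) → (proj₁ (symmetric x y) xy∈K , xy≢ba ∘ cong swap) , xy≢ab ∘ cong swap) ,
    (λ ((yx∈K , yx≢ab) , yx≢ba) → (proj₂ (symmetric x y) yx∈K , yx≢ba ∘ cong swap) , yx≢ab ∘ cong swap)

  -- If (c , d) dominates (a , b), then (d , c) dominates (b , a); when (d , c) is the removed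
  -- (a , b) itself, the diagonal element (b , b) takes its place.
  Dismantle-removePair : DecidableEquality A → ∀ {K} → Symmetric K → (∀ x → K (x , x)) →
    ∀ {a b} → a ≢ b → K (a , b) → Dominated 𝕀² K (a , b) →
    Dismantle 𝕀² NonDiagonal K ((K ─ (a , b)) ─ (b , a))
  Dismantle-removePair _≟_ {K} symmetric diagonal∈K {a} {b} a≢b ab∈K dominated@((c , d) , cd∈K , cd≢ab , dom) =
    fold (a , b) ab∈K dominated a≢b
      (fold (b , a) (proj₁ (symmetric a b) ab∈K , a≢b ∘ sym ∘ cong proj₁) ba-dominated (a≢b ∘ sym)
        (done (λ _ p → p) (λ _ p → p)))
    where
    dc-dominates : Dominates 𝕀² (K ─ (a , b)) (d , c) (b , a)
    dc-dominates = Dominates-antimono 𝕀² (λ _ → proj₁) (Dominates-swap symmetric dom)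
    ba-dominated : Dominated 𝕀² (K ─ (a , b)) (b , a)
    ba-dominated with c ≟ b
    ... | yes refl = (b , b) , (diagonal∈K b , a≢b ∘ sym ∘ cong proj₁) , a≢b ∘ sym ∘ cong proj₂ ,
                     Dominates-fixProj₁ dc-dominates
    ... | no c≢b   = (d , c) , (proj₁ (symmetric c d) cd∈K , c≢b ∘ cong proj₂) , cd≢ab ∘ cong swap , dc-dominates

lemma4p1 : {τ : Signature} (𝕀 : Structure τ) → Countable (U 𝕀) →
    (J : Subset (U 𝕀)) → NonFoldable 𝕀 full J →
    (K : Subset (U 𝕀 × U 𝕀)) → SymObtained 𝕀 K → Minimal 𝕀 K →
    NonFoldable (square 𝕀) K (Δ² J)
lemma4p1 𝕀 countable J nonFoldable K obtained@(symmetric , full→K) minimal (a , b) ab∈K dominated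
  with Countable⇒DecidableEquality countable
... | _≟_ with a ≟ b
...   | yes refl = nonFoldable a tt (Dominated-diagonal⇒Dominated 𝕀 _≟_ diagonal∈K dominated) , refl
  where diagonal∈K = SymObtained-diagonal 𝕀 obtained
...   | no a≢b = ⊥-elim (minimal smaller (λ _ → proj₁ ∘ proj₁) smaller-obtained
                           ((a , b) , ab∈K , λ ab∈smaller → proj₂ (proj₁ ab∈smaller) refl))
  where
  smaller : Subset (U 𝕀 × U 𝕀)
  smaller = (K ─ (a , b)) ─ (b , a)
  smaller-obtained : SymObtained 𝕀 smaller
  smaller-obtained =
    Symmetric-removePair 𝕀 symmetric a b ,
    Dismantle-trans (square 𝕀) full→K
      (Dismantle-removePair 𝕀 _≟_ symmetric (SymObtained-diagonal 𝕀 obtained) a≢b ab∈K dominated)
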